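{- Over $m$ arc additions, topological search spends $\mathrm{O}(n^2)$ total time testing for cycles; that is, the sum over all additions that trigger a search of $|F|\cdot|B|$, where $F$ and $B$ are the queues at the end of that search, is $\mathrm{O}(n^2)$.
   Context: Incremental setting: $n$ fixed vertices, initially no arcs; distinct arcs are added one at a time ($m$ in total) and processing stops once a cycle is detected. Vertices are numbered by a bijection $\mathit{position}$ onto $\{1,\dots,n\}$ (inverse array $\mathit{vertex}$), kept topological; arcs are tested via an adjacency matrix in $\mathrm{O}(1)$ time. When an arc $(v,w)$ with $\mathit{position}(v)>\mathit{position}(w)$ is added, topological search runs: $F=[w]$, $B=[v]$ (queues), $i=\mathit{position}(w)$, $j=\mathit{position}(v)$, $\mathit{vertex}(i)=\mathit{vertex}(j)=$ null; repeat: $i=i+1$, and while $i<j$ and no $u\in F$ has an arc to $\mathit{vertex}(i)$, $i=i+1$; if $i=j$ stop, else append $\mathit{vertex}(i)$ to $F$ and set $\mathit{vertex}(i)=$ null; $j=j-1$, and while $i<j$ and no $z\in B$ has an arc from $\mathit{vertex}(j)$, $j=j-1$; if $i=j$ stop, else append $\mathit{vertex}(j)$ to $B$ and set $\mathit{vertex}(j)=$ null. The cycle test then checks every pair $u\in F$, $z\in B$ for an arc $(u,z)$ (time $\mathrm{O}(|F||B|)$), reporting a cycle iff one exists; if none, the vertices are reordered (by a reordering step that moves vertices added to $F$ to higher positions and those added to $B$ to lower positions, producing a topological numbering). -}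

module Defs where

open import Data.Nat using (ℕ; zero; suc; _+_; _*_; _∸_; _<_; _<ᵇ_; _≡ᵇ_)
open import Data.Bool using (Bool; true; false; if_then_else_; _∨_; _∧_)
open import Data.Fin using (Fin; toℕ; fromℕ<)
open import Data.Fin.Properties using () renaming (_≟_ to _≟ᶠ_)
open import Data.Maybe using (Maybe; just; nothing)
open import Data.List using (List; []; _∷_; _++_; [_]; length)
open import Data.Bool.ListAction using (any)
open import Data.Product using (_×_; _,_)
open import Data.Nat.Properties using (_<?_)
open import Function.Bundles using (_↔_; Inverse)
open import Relation.Nullary.Decidable using (⌊_⌋; yes; no)
open import Relation.Binary.PropositionalEquality using (_≡_)

-- A digraph on the vertex set Fin n, given by its adjacency matrix
-- (arc test in O(1)).
Adj : ℕ → Set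
Adj n = Fin n → Fin n → Bool

emptyGraph : ∀ {n} → Adj n
emptyGraph _ _ = false

addArc : ∀ {n} → Adj n → Fin n → Fin n → Adj n
addArc G v w x y = (⌊ x ≟ᶠ v ⌋ ∧ ⌊ y ≟ᶠ w ⌋) ∨ G x y

-- A numbering: a bijection position : vertices → positions
-- (positions are Fin n, i.e. 0..n-1 instead of 1..n);
-- Inverse.to = position, Inverse.from = vertex.
Numbering : ℕ → Set
Numbering n = Fin n ↔ Fin n

position : ∀ {n} → Numbering n → Fin n → Fin n
position N = Inverse.to N

vertexAt : ∀ {n} → Numbering n → Fin n → Fin n
vertexAt N = Inverse.from N

IsTopological : ∀ {n} → Adj n → Numbering n → Set
IsTopological G N =
  ∀ u v → G u v ≡ true → toℕ (position N u) < toℕ (position N v)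

-- the (mutable) vertex array during search, indexed by positions (as ℕ);
-- 'nothing' = null (also used for out-of-range indices)
VArr : ℕ → Set
VArr n = ℕ → Maybe (Fin n)

initVArr : ∀ {n} → Numbering n → VArr n
initVArr {n} N k with k <? n
... | yes k<n = just (vertexAt N (fromℕ< k<n))
... | no _    = nothing

setNull : ∀ {n} → VArr n → ℕ → VArr n
setNull A k k' = if k ≡ᵇ k' then nothing else A k'

arcFromSome : ∀ {n} → Adj n → List (Fin n) → Maybe (Fin n) → Bool
arcFromSome G F nothing  = false
arcFromSome G F (just x) = any (λ u → G u x) F

arcToSome : ∀ {n} → Adj n → List (Fin n) → Maybe (Fin n) → Bool
arcToSome G B nothing  = false
arcToSome G B (just x) = any (λ z → G x z) B

-- forward scan: "while i < j and no u ∈ F has an arc to vertex(i), i = i+1"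
-- (the first argument is fuel; fuel n always suffices)
scanF : ∀ {n} → ℕ → Adj n → List (Fin n) → VArr n → ℕ → ℕ → ℕ
scanF zero    G F A i j = i
scanF (suc g) G F A i j =
  if i <ᵇ j
  then (if arcFromSome G F (A i) then i else scanF g G F A (suc i) j)
  else i

scanB : ∀ {n} → ℕ → Adj n → List (Fin n) → VArr n → ℕ → ℕ → ℕ
scanB zero    G B A i j = j
scanB (suc g) G B A i j =
  if i <ᵇ j
  then (if arcToSome G B (A j) then j else scanB g G B A i (j ∸ 1))
  else j

-- main loop of topological search; returns the final queues (F , B).
-- The first argument is fuel; each round shrinks j - i, so fuel n suffices.
searchLoop : ∀ {n} → ℕ → Adj n → List (Fin n) → List (Fin n) → VArr n
           → ℕ → ℕ → List (Fin n) × List (Fin n)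
searchLoop zero    G F B A i j = F , B
searchLoop {n} (suc g) G F B A i j = forward (scanF n G F A (suc i) j)
  where
  backward : List (Fin n) → VArr n → ℕ → ℕ → List (Fin n) × List (Fin n)
  backward F' A' i' j' with i' ≡ᵇ j' | A' j'
  ... | true  | _       = F' , B
  ... | false | nothing = F' , B
  ... | false | just y  = searchLoop g G F' (B ++ [ y ]) (setNull A' j') i' j'

  forward : ℕ → List (Fin n) × List (Fin n)
  forward i' with i' ≡ᵇ j | A i'
  ... | true  | _       = F , B
  ... | false | nothing = F , B
  ... | false | just x  =
    backward (F ++ [ x ]) (setNull A i') i' (scanB n G B (setNull A i') i' (j ∸ 1))

-- topological search after adding arc (v , w) with position v > position w;
-- G is the graph including the new arc.
topSearch : ∀ {n} → Adj n → Numbering n → Fin n → Fin n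
          → List (Fin n) × List (Fin n)
topSearch {n} G N v w =
  searchLoop n G [ w ] [ v ] (setNull (setNull (initVArr N) i) j) i j
  where
  i = toℕ (position N w)
  j = toℕ (position N v)

cycleTest : ∀ {n} → Adj n → List (Fin n) → List (Fin n) → Bool
cycleTest G F B = any (λ u → any (λ z → G u z) B) F

testCost : ∀ {n} → List (Fin n) → List (Fin n) → ℕ
testCost F B = length F * length B

-- Which reorder is used is
-- left abstract; the only requirement (see Valid) is that it produces a
-- topological numbering, as in the paper.
Reorder : ℕ → Set
Reorder n = Adj n → Numbering n → List (Fin n) → List (Fin n) → Numbering n

data StepResult (n : ℕ) : Set where
  stopped   : ℕ → StepResult n                         -- cycle found, with test cost
  continued : ℕ → Adj n → Numbering n → StepResult n   -- test cost, new graph, new numbering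

step : ∀ {n} → Reorder n → Adj n → Numbering n → Fin n × Fin n → StepResult n
step R G N (v , w) with toℕ (position N w) <? toℕ (position N v)
... | no _  = continued 0 (addArc G v w) N
... | yes _ with topSearch (addArc G v w) N v w
...   | F , B =
  if cycleTest (addArc G v w) F B
  then stopped (testCost F B)
  else continued (testCost F B) (addArc G v w) (R (addArc G v w) N F B)

totalTestCost : ∀ {n} → Reorder n → Adj n → Numbering n → List (Fin n × Fin n) → ℕ
totalTestCost R G N []       = 0
totalTestCost R G N (a ∷ as) with step R G N a
... | stopped c        = c
... | continued c G' N' = c + totalTestCost R G' N' as

Valid : ∀ {n} → Reorder n → Adj n → Numbering n → List (Fin n × Fin n) → Set
Valid R G N []       = Data.Unit.⊤ where import Data.Unit
Valid R G N (a ∷ as) with step R G N a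
... | stopped c         = Data.Unit.⊤ where import Data.Unit
... | continued c G' N' = IsTopological G' N' × Valid R G' N' as

module Submission where

-- Idea (charging argument).  Consider a search triggered by the arc (v , w)
-- that finds no cycle, with final queues F and B.  Every vertex of F is
-- reachable from w and every vertex of B reaches v, and F lies at positions
-- strictly below those of B.  Hence for z ∈ B and u ∈ F the pair (z , u) is
-- NEWLY reachable: z ⇝ v → w ⇝ u in the new graph, while in the old graph
-- z cannot reach u because the old numbering is topological and
-- position u < position z.  Reachability only grows, so the |F|·|B| pairs
-- charged by different searches are all distinct; being pairs of vertices
-- there are at most n² of them.  The last search, which finds a cycle,
-- costs |F|·|B| ≤ n·n because the queues are duplicate-free.

open import Defs
open import Data.Nat using (ℕ; zero; suc; _*_; _≤_; _<_; _+_; _∸_; z≤n; s≤s; _≡ᵇ_; _<ᵇ_)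
open import Data.Nat.Properties
open import Data.Fin using (Fin; toℕ; fromℕ<)
open import Data.Fin.Properties using (toℕ-fromℕ<; toℕ<n) renaming (_≟_ to _≟ᶠ_)
open import Data.List using (List; []; _∷_; _++_; [_]; length; map; allFin; cartesianProduct)
open import Data.List.Properties using (length-++; length-map; length-tabulate; length-removeAt′)
open import Data.List.Relation.Unary.Unique.Propositional using (Unique)
import Data.List.Relation.Unary.Unique.Propositional.Properties as Unique
open import Data.List.Relation.Unary.All as All using (All; []; _∷_)
import Data.List.Relation.Unary.All.Properties as All
open import Data.List.Relation.Unary.Any as Any using (here; there; _─_)
open import Data.List.Relation.Unary.Any.Properties using (any⁻)
open import Data.List.Relation.Unary.AllPairs using ([]; _∷_)
open import Data.List.Membership.Propositional using (_∈_; _∉_)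
open import Data.List.Membership.Propositional.Properties using (∈-allFin; ∈-cartesianProduct⁺)
open import Data.Product using (∃; _×_; _,_; proj₁; proj₂; Σ)
open import Data.Bool using (true; false; T; _∨_)
open import Data.Bool.Properties using (∨-zeroʳ; T-≡)
open import Data.Maybe using (just; nothing)
open import Relation.Binary.PropositionalEquality hiding ([_])
open import Relation.Binary.Construct.Closure.ReflexiveTransitive using (Star; ε; _◅_; _◅◅_)
open import Relation.Nullary using (¬_; yes; no)
open import Data.Empty using (⊥-elim)
open import Data.Sum using (_⊎_; inj₁; inj₂)
open import Function.Bundles using (Inverse; Equivalence)

-- Counting duplicate-free lists

module _ {a} {A : Set a} where

  ∈-─ : ∀ {x y : A} ys (x∈ys : x ∈ ys) → y ∈ ys → y ≢ x → y ∈ (ys ─ x∈ys)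
  ∈-─ (_ ∷ _) (here refl) (here refl) y≢x = ⊥-elim (y≢x refl)
  ∈-─ (_ ∷ _) (here refl) (there y∈)  _   = y∈
  ∈-─ (_ ∷ _) (there _)   (here refl) _   = here refl
  ∈-─ (_ ∷ ys) (there x∈) (there y∈)  y≢x = there (∈-─ ys x∈ y∈ y≢x)

  unique-⊆⇒length≤ : ∀ {xs : List A} ys → Unique xs → (∀ {x} → x ∈ xs → x ∈ ys) →
                     length xs ≤ length ys
  unique-⊆⇒length≤ ys [] _ = z≤n
  unique-⊆⇒length≤ {x ∷ xs} ys (x∉xs ∷ uxs) xs⊆ys =
    subst (suc (length xs) ≤_) (sym (length-removeAt′ ys (Any.index x∈ys)))
      (s≤s (unique-⊆⇒length≤ (ys ─ x∈ys) uxs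
        λ y∈xs → ∈-─ ys x∈ys (xs⊆ys (there y∈xs)) λ y≡x → All.lookup x∉xs y∈xs (sym y≡x)))
    where x∈ys = xs⊆ys (here refl)

length-cartesianProduct : ∀ {a b} {A : Set a} {B : Set b} (xs : List A) (ys : List B) →
                          length (cartesianProduct xs ys) ≡ length xs * length ys
length-cartesianProduct []       ys = refl
length-cartesianProduct (x ∷ xs) ys = begin
  length (map (x ,_) ys ++ cartesianProduct xs ys)    ≡⟨ length-++ (map (x ,_) ys) ⟩
  length (map (x ,_) ys) + length (cartesianProduct xs ys)
    ≡⟨ cong₂ _+_ (length-map (x ,_) ys) (length-cartesianProduct xs ys) ⟩
  length ys + length xs * length ys                   ∎
  where open ≡-Reasoning

unique-vertices : ∀ {n} {L : List (Fin n)} → Unique L → length L ≤ n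
unique-vertices {n} {L} uL = subst (length L ≤_) (length-tabulate {n = n} (λ x → x))
  (unique-⊆⇒length≤ (allFin n) uL λ {x} _ → ∈-allFin x)

unique-pairs : ∀ {n} {L : List (Fin n × Fin n)} → Unique L → length L ≤ n * n
unique-pairs {n} {L} uL = subst (length L ≤_) allPairs-length
  (unique-⊆⇒length≤ (cartesianProduct (allFin n) (allFin n)) uL
    λ {(x , y)} _ → ∈-cartesianProduct⁺ (∈-allFin x) (∈-allFin y))
  where
  allPairs-length : length (cartesianProduct (allFin n) (allFin n)) ≡ n * n
  allPairs-length = trans (length-cartesianProduct (allFin n) (allFin n))
    (cong₂ _*_ (length-tabulate {n = n} (λ x → x)) (length-tabulate {n = n} (λ x → x)))

Arc : ∀ {n} → Adj n → Fin n → Fin n → Set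
Arc G x y = G x y ≡ true

Reach : ∀ {n} → Adj n → Fin n → Fin n → Set
Reach G = Star (Arc G)

ReachPair : ∀ {n} → Adj n → Fin n × Fin n → Set
ReachPair G (x , y) = Reach G x y

topological-reach : ∀ {n} {G : Adj n} {N : Numbering n} → IsTopological G N →
                    ∀ {x y} → Reach G x y → toℕ (position N x) ≤ toℕ (position N y)
topological-reach top ε = ≤-refl
topological-reach {G = G} {N} top {x} (_◅_ {j = j} e r) =
  ≤-trans (<⇒≤ (top x j e)) (topological-reach {G = G} {N} top r)

addArc-arc : ∀ {n} (G : Adj n) v w → Arc (addArc G v w) v w
addArc-arc G v w with v ≟ᶠ v | w ≟ᶠ w
... | yes _ | yes _ = refl
... | no v≢v | _    = ⊥-elim (v≢v refl)
... | yes _ | no w≢w = ⊥-elim (w≢w refl)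

addArc-reach : ∀ {n} (G : Adj n) v w {x y} → Reach G x y → Reach (addArc G v w) x y
addArc-reach G v w ε = ε
addArc-reach G v w (e ◅ r) =
  subst (λ b → _ ∨ b ≡ true) (sym e) (∨-zeroʳ _) ◅ addArc-reach G v w r

<ᵇ-true : ∀ m n → (m <ᵇ n) ≡ true → m < n
<ᵇ-true m n e = <ᵇ⇒< m n (subst T (sym e) _)

<ᵇ-false : ∀ m n → (m <ᵇ n) ≡ false → ¬ m < n
<ᵇ-false m n e m<n = subst T e (<⇒<ᵇ m<n)

≡ᵇ-false : ∀ m n → (m ≡ᵇ n) ≡ false → m ≢ n
≡ᵇ-false m n e m≡n = subst T e (≡⇒≡ᵇ m n m≡n)

<⇒≤∸1 : ∀ {m n} → m < n → m ≤ n ∸ 1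
<⇒≤∸1 (s≤s m≤n) = m≤n

≤∸1⇒< : ∀ {l m n} → l < n → m ≤ n ∸ 1 → m < n
≤∸1⇒< {n = suc n} _ m≤n = s≤s m≤n

-- Each scan step shrinks the gap between the two indices by one, so fuel
-- equal to the gap suffices.
gap-shrinks : ∀ {s j g} → s < j → j ∸ s ≤ suc g → j ∸ suc s ≤ g
gap-shrinks s<j gap = ≤-pred (≤-trans (≤-reflexive (sym (+-∸-assoc 1 s<j))) gap)

-- Correctness of topological search for the back arc (v , w) in the graph
-- G that already contains it: the final queues are separated by position
-- and linked to w and v by paths.

module Search {n : ℕ} (G : Adj n) (N : Numbering n) (v w : Fin n) where

  pos : Fin n → ℕ
  pos x = toℕ (position N x)

  Faithful : VArr n → Set
  Faithful A = ∀ k x → A k ≡ just x → pos x ≡ k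

  -- Nulling entries keeps the array faithful; initially it is faithful
  -- because vertex is the inverse of position.
  setNull-faithful : ∀ {A} k → Faithful A → Faithful (setNull A k)
  setNull-faithful {A} k fA k' x e with k ≡ᵇ k'
  ... | false = fA k' x e

  init-faithful : Faithful (initVArr N)
  init-faithful k x e with k <? n
  init-faithful k x refl | yes k<n =
    trans (cong toℕ (Inverse.strictlyInverseˡ N (fromℕ< k<n))) (toℕ-fromℕ< k<n)

  setNull-other : ∀ (A : VArr n) k k' → (k ≡ᵇ k') ≡ false → setNull A k k' ≡ A k'
  setNull-other A k k' e rewrite e = refl

  arcFrom-reach : ∀ {F x} → All (Reach G w) F → arcFromSome G F (just x) ≡ true → Reach G w x
  arcFrom-reach {F} wF e = All.lookupWith (λ r arc → r ◅◅ (Equivalence.to T-≡ arc ◅ ε))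
    wF (any⁻ _ F (Equivalence.from T-≡ e))

  arcTo-reach : ∀ {B x} → All (λ z → Reach G z v) B → arcToSome G B (just x) ≡ true → Reach G x v
  arcTo-reach {B} Bv e = All.lookupWith (λ r arc → Equivalence.to T-≡ arc ◅ r)
    Bv (any⁻ _ B (Equivalence.from T-≡ e))

  scanF-result : ∀ F A j g s → j ∸ s ≤ g → s ≤ j →
    (scanF g G F A s j ≡ j) ⊎
    (s ≤ scanF g G F A s j × scanF g G F A s j < j × arcFromSome G F (A (scanF g G F A s j)) ≡ true)
  scanF-result F A j zero s d s≤j = inj₁ (≤-antisym s≤j (m∸n≡0⇒m≤n (n≤0⇒n≡0 d)))
  scanF-result F A j (suc g) s d s≤j with s <ᵇ j in s<ᵇj
  ... | false = inj₁ (≤-antisym s≤j (≮⇒≥ (<ᵇ-false s j s<ᵇj)))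
  ... | true with arcFromSome G F (A s) in arc
  ...   | true = inj₂ (≤-refl , <ᵇ-true s j s<ᵇj , arc)
  ...   | false with scanF-result F A j g (suc s) (gap-shrinks (<ᵇ-true s j s<ᵇj) d) (<ᵇ-true s j s<ᵇj)
  ...     | inj₁ met = inj₁ met
  ...     | inj₂ (s<t , t<j , arc') = inj₂ (≤-trans (n≤1+n s) s<t , t<j , arc')

  scanB-result : ∀ B A i g t → t ∸ i ≤ g → i ≤ t →
    (scanB g G B A i t ≡ i) ⊎
    (i < scanB g G B A i t × scanB g G B A i t ≤ t × arcToSome G B (A (scanB g G B A i t)) ≡ true)
  scanB-result B A i zero t d i≤t = inj₁ (≤-antisym (m∸n≡0⇒m≤n (n≤0⇒n≡0 d)) i≤t)
  scanB-result B A i (suc g) t d i≤t with i <ᵇ t in i<ᵇt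
  ... | false = inj₁ (≤-antisym (≮⇒≥ (<ᵇ-false i t i<ᵇt)) i≤t)
  ... | true with arcToSome G B (A t) in arc
  ...   | true = inj₂ (<ᵇ-true i t i<ᵇt , ≤-refl , arc)
  ...   | false with scanB-result B A i g (t ∸ 1) fuel (<⇒≤∸1 (<ᵇ-true i t i<ᵇt))
    where fuel = subst (_≤ g) (sym (∸-+-assoc t 1 i)) (gap-shrinks (<ᵇ-true i t i<ᵇt) d)
  ...     | inj₁ met = inj₁ met
  ...     | inj₂ (i<s , s≤t , arc') = inj₂ (i<s , ≤-trans s≤t (m∸n≤m t 1) , arc')

  record Invariant (F B : List (Fin n)) (A : VArr n) (i j : ℕ) : Set where
    field
      faithful : Faithful A
      i<j      : i < j
      j≤n      : j ≤ n
      F-below  : All (λ u → pos u ≤ i) F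
      B-above  : All (λ z → j ≤ pos z) B
      F-reach  : All (Reach G w) F
      B-reach  : All (λ z → Reach G z v) B
      F-unique : Unique F
      B-unique : Unique B

  SearchOutcome : List (Fin n) × List (Fin n) → Set
  SearchOutcome (F , B) =
    Unique F × Unique B × All (Reach G w) F × All (λ z → Reach G z v) B ×
    Σ ℕ λ k → All (λ u → pos u ≤ k) F × All (λ z → k < pos z) B

  -- Whenever the loop stops, the invariant yields the outcome with k = i.
  outcome : ∀ {F B A i j} → Invariant F B A i j → SearchOutcome (F , B)
  outcome I = F-unique , B-unique , F-reach , B-reach , _ , F-below , All.map (<-≤-trans i<j) B-above
    where open Invariant I

  snoc-unique : ∀ {xs : List (Fin n)} {x} → Unique xs → x ∉ xs → Unique (xs ++ [ x ])
  snoc-unique uxs x∉xs = Unique.++⁺ uxs ([] ∷ []) λ { (x∈xs , here refl) → x∉xs x∈xs }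

  push-F : ∀ {F B A i j s x} → Invariant F B A i j → suc i ≤ s → s < j → A s ≡ just x →
           arcFromSome G F (just x) ≡ true → Invariant (F ++ [ x ]) B (setNull A s) s j
  push-F {i = i} {s = s} {x} I i<s s<j e arc = record
    { faithful = setNull-faithful s faithful ; i<j = s<j ; j≤n = j≤n
    ; F-below  = All.++⁺ (All.map (λ u≤i → ≤-trans u≤i (<⇒≤ i<s)) F-below) (≤-reflexive x-at-s ∷ [])
    ; B-above  = B-above
    ; F-reach  = All.++⁺ F-reach (arcFrom-reach F-reach arc ∷ [])
    ; B-reach  = B-reach
    ; F-unique = snoc-unique F-unique λ x∈F →
        <⇒≱ i<s (subst (_≤ i) x-at-s (All.lookup F-below x∈F))
    ; B-unique = B-unique }
    where
    open Invariant I
    x-at-s : pos x ≡ s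
    x-at-s = faithful s x e

  push-B : ∀ {F B A i j t y} → Invariant F B A i j → i < t → suc t ≤ j → A t ≡ just y →
           arcToSome G B (just y) ≡ true → Invariant F (B ++ [ y ]) (setNull A t) i t
  push-B {j = j} {t = t} {y} I i<t t<j e arc = record
    { faithful = setNull-faithful t faithful ; i<j = i<t ; j≤n = ≤-trans (<⇒≤ t<j) j≤n
    ; F-below  = F-below
    ; B-above  = All.++⁺ (All.map (≤-trans (<⇒≤ t<j)) B-above) (≤-reflexive (sym y-at-t) ∷ [])
    ; F-reach  = F-reach
    ; B-reach  = All.++⁺ B-reach (arcTo-reach B-reach arc ∷ [])
    ; F-unique = F-unique
    ; B-unique = snoc-unique B-unique λ y∈B →
        <⇒≱ t<j (subst (j ≤_) y-at-t (All.lookup B-above y∈B)) }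
    where
    open Invariant I
    y-at-t : pos y ≡ t
    y-at-t = faithful t y e

  loop : ∀ g F B A i j → Invariant F B A i j → SearchOutcome (searchLoop g G F B A i j)
  loop zero F B A i j I = outcome I
  loop (suc g) F B A i j I
    with scanF n G F A (suc i) j
       | scanF-result F A j n (suc i) (≤-trans (m∸n≤m j (suc i)) (Invariant.j≤n I)) (Invariant.i<j I)
  ... | s | forward with s ≡ᵇ j in s≡ᵇj | A s in As
  ...   | true  | _       = outcome I
  ...   | false | nothing = outcome I
  ...   | false | just x with forward
  ...     | inj₁ s≡j = ⊥-elim (≡ᵇ-false s j s≡ᵇj s≡j)
  ...     | inj₂ (i<s , s<j , arcF)
      with scanB n G B (setNull A s) s (j ∸ 1)
         | scanB-result B (setNull A s) s n (j ∸ 1)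
             (≤-trans (m∸n≤m (j ∸ 1) s) (≤-trans (m∸n≤m j 1) (Invariant.j≤n I))) (<⇒≤∸1 s<j)
  ...       | t | backward with s ≡ᵇ t in s≡ᵇt
  ...         | true = outcome (push-F I i<s s<j As arcF)
  ...         | false with A t in At
  ...           | nothing = outcome (push-F I i<s s<j As arcF)
  ...           | just y with backward
  ...             | inj₁ t≡s = ⊥-elim (≡ᵇ-false s t s≡ᵇt (sym t≡s))
  ...             | inj₂ (s<t , t≤j-1 , arcB) =
                loop g (F ++ [ x ]) (B ++ [ y ]) (setNull (setNull A s) t) s t
                  (push-B (push-F I i<s s<j As arcF) s<t (≤∸1⇒< s<j t≤j-1)
                          (trans (setNull-other A s t s≡ᵇt) At) arcB)

searchOutcome : ∀ {n} (G : Adj n) N v w → toℕ (position N w) < toℕ (position N v) →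
  Search.SearchOutcome (addArc G v w) N v w (topSearch (addArc G v w) N v w)
searchOutcome {n} G N v w w<v = loop n (w ∷ []) (v ∷ []) _ _ _ record
  { faithful = setNull-faithful (pos v) (setNull-faithful (pos w) init-faithful)
  ; i<j = w<v ; j≤n = <⇒≤ (toℕ<n _)
  ; F-below = ≤-refl ∷ [] ; B-above = ≤-refl ∷ []
  ; F-reach = ε ∷ [] ; B-reach = ε ∷ []
  ; F-unique = [] ∷ [] ; B-unique = [] ∷ [] }
  where open Search (addArc G v w) N v w

data StepCharge {n} (G : Adj n) : StepResult n → Set where
  stop : ∀ {c} → c ≤ n * n → StepCharge G (stopped c)
  continue : ∀ {c G' N'} (S : List (Fin n × Fin n)) → Unique S → length S ≡ c →
    All (λ a → ReachPair G' a × ¬ ReachPair G a) S →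
    (∀ {x y} → Reach G x y → Reach G' x y) → StepCharge G (continued c G' N')

-- Every step from a topologically numbered graph is charged as above: a
-- forward arc costs nothing, and a back arc (v , w) is charged the pairs
-- B × F of its search.
stepCharge : ∀ {n} (R : Reorder n) G N a → IsTopological G N → StepCharge G (step R G N a)
stepCharge R G N (v , w) top with toℕ (position N w) <? toℕ (position N v)
... | no _ = continue [] [] refl [] (addArc-reach G v w)
... | yes w<v with topSearch (addArc G v w) N v w | searchOutcome G N v w w<v
...   | F , B | uF , uB , wF , Bv , _ , F≤k , k<B with cycleTest (addArc G v w) F B
...     | true = stop (*-mono-≤ (unique-vertices uF) (unique-vertices uB))
...     | false = continue (cartesianProduct B F) (Unique.cartesianProduct⁺ uB uF)
          (trans (length-cartesianProduct B F) (*-comm (length B) (length F)))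
          (All.cartesianProduct⁺ (setoid _) (setoid _) B F newlyReachable)
          (addArc-reach G v w)
  where
  -- z ∈ B reaches u ∈ F through the new arc, but not before: the old
  -- numbering is topological and u lies below z.
  newlyReachable : ∀ {z u} → z ∈ B → u ∈ F →
                   ReachPair (addArc G v w) (z , u) × ¬ ReachPair G (z , u)
  newlyReachable z∈B u∈F =
    All.lookup Bv z∈B ◅◅ (addArc-arc G v w ◅ All.lookup wF u∈F) ,
    λ z⇝u → <⇒≱ (≤-<-trans (All.lookup F≤k u∈F) (All.lookup k<B z∈B))
                (topological-reach {G = G} {N} top z⇝u)

runCharge : ∀ {n} (R : Reorder n) (G : Adj n) N arcs → IsTopological G N → Valid R G N arcs →
  Σ (List (Fin n × Fin n)) λ L → Unique L × All (λ a → ¬ ReachPair G a) L ×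
    totalTestCost R G N arcs ≤ length L + n * n
runCharge R G N [] top valid = [] , [] , [] , z≤n
runCharge {n} R G N (a ∷ as) top valid with step R G N a | stepCharge R G N a top
... | stopped c | stop c≤n² = [] , [] , [] , c≤n²
... | continued c G' N' | continue S uS |S|≡c S-new grows with valid
...   | top' , valid' with runCharge R G' N' as top' valid'
...     | L , uL , L-unreachable , cost≤ =
  S ++ L ,
  Unique.++⁺ uS uL (λ (a∈S , a∈L) → All.lookup L-unreachable a∈L (proj₁ (All.lookup S-new a∈S))) ,
  All.++⁺ (All.map proj₂ S-new) (All.map (λ ¬r r → ¬r (grows r)) L-unreachable) ,
  (begin
    c + totalTestCost R G' N' as        ≤⟨ +-monoʳ-≤ c cost≤ ⟩
    c + (length L + n * n)              ≡⟨ cong (_+ _) (sym |S|≡c) ⟩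
    length S + (length L + n * n)       ≡⟨ sym (+-assoc (length S) (length L) (n * n)) ⟩
    (length S + length L) + n * n       ≡⟨ cong (_+ n * n) (sym (length-++ S)) ⟩
    length (S ++ L) + n * n             ∎)
  where open ≤-Reasoning

-- Starting from the empty graph no pair is reachable, so the charged pairs
-- number at most n², and the total cost is at most 2·n².
lemma5p2 : ∃ λ (c : ℕ) →
    ∀ (n : ℕ) (N₀ : Numbering n) (R : Reorder n) (arcs : List (Fin n × Fin n)) →
    Unique arcs →
    Valid R emptyGraph N₀ arcs →
    totalTestCost R emptyGraph N₀ arcs ≤ c * (n * n)
lemma5p2 = 2 , λ n N₀ R arcs _ valid →
  let L , uL , _ , cost≤ = runCharge R emptyGraph N₀ arcs (λ _ _ ()) valid
      open ≤-Reasoning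
  in begin
    totalTestCost R emptyGraph N₀ arcs  ≤⟨ cost≤ ⟩
    length L + n * n                    ≤⟨ +-monoˡ-≤ (n * n) (unique-pairs uL) ⟩
    n * n + n * n                       ≡⟨ cong (n * n +_) (sym (+-identityʳ (n * n))) ⟩
    2 * (n * n)                         ∎
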